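{- Let $(M,w)$ and $(M',w')$ be collectively $\mathtt{P}$-bisimilar pointed models. Then for every $\psi\in\mathcal{L}_{!}$, $(M,w)\Vdash\psi$ if and only if $(M',w')\Vdash\psi$.
   Context: Fix a finite non-empty set of agents $A$ and a non-empty countable set of atoms $\mathtt{P}$. A model is $M=\langle W,R,V\rangle$ with $W$ non-empty, $R=\{R_i\subseteq W\times W\mid i\in A\}$ arbitrary relations, $V:\mathtt{P}\to\mathcal{P}(W)$; $R_G:=\bigcap_{k\in G}R_k$ (with $R_\emptyset:=W\times W$). $\mathcal{L}_D$: $\varphi::=p\mid\lnot\varphi\mid\varphi\land\varphi\mid D_G\varphi$ ($\emptyset\neq G\subseteq A$), with $(M,w)\Vdash D_G\varphi$ iff $\varphi$ holds at all $u$ with $(w,u)\in R_G$. $\|\xi\|^M$ is the truth set of $\xi$, $\sim^M_\xi:=(\|\xi\|^M\times\|\xi\|^M)\cup(\|\lnot\xi\|^M\times\|\lnot\xi\|^M)$, and $M^{!\xi}=\langle W,R^{!\xi},V\rangle$ with $R^{!\xi}_i:=R_i\cap\sim^M_\xi$. $\mathcal{L}_{!}$ is $\bigcup_n\mathcal{L}_!^n$ with $\mathcal{L}_!^0=\mathcal{L}_D$ and $\mathcal{L}_!^{n+1}$ extending $\mathcal{L}_!^n$ with $[\xi]\varphi$ for $\xi\in\mathcal{L}_!^n$, where $(M,w)\Vdash[\xi]\varphi$ iff $(M,w)\Vdash\xi$ implies $(M^{!\xi},w)\Vdash\varphi$. A collective $\mathtt{P}$-bisimulation between $M$ and $M'=\langle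 W',R',V'\rangle$ is a non-empty $Z\subseteq W\times W'$ such that each $(u,u')\in Z$ satisfies: same atoms; for every $G\subseteq A$ and $(u,v)\in R_G$ some $v'$ has $(u',v')\in R'_G$, $(v,v')\in Z$; and symmetrically (back). $(M,w),(M',w')$ are collectively $\mathtt{P}$-bisimilar if such a $Z$ contains $(w,w')$. -}

module Defs where

open import Data.Nat using (ℕ; suc)
open import Data.Fin using (Fin)
open import Data.Fin.Subset using (Subset; _∈_; Nonempty)
open import Data.Product using (Σ; _×_; ∃)
open import Data.Sum using (_⊎_)
open import Relation.Nullary using (¬_)
open import Function.Bundles using (_⇔_)

-- Agents: the finite non-empty set  A = Fin (suc k).
-- Atoms: an arbitrary type P (countability / non-emptiness are hypotheses
-- of the theorem).

record Model (k : ℕ) (P : Set) : Set₁ where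
  field
    W : Set
    R : Fin (suc k) → W → W → Set
    V : P → W → Set
open Model public

RG : ∀ {k P} (M : Model k P) → Subset (suc k) → W M → W M → Set
RG M G u v = ∀ i → i ∈ G → R M i u v

-- The language L_! (public announcement + distributed knowledge).
-- L_! = ⋃_n L_!^n is exactly the set of all finite terms of this grammar.
data Form (k : ℕ) (P : Set) : Set where
  atom : P → Form k P
  ¬′_  : Form k P → Form k P
  _∧′_ : Form k P → Form k P → Form k P
  D    : (G : Subset (suc k)) → Nonempty G → Form k P → Form k P
  [_]_ : Form k P → Form k P → Form k P

-- Satisfaction on the components ⟨W , R , V⟩ of a model (the model changes
-- under announcements, so we recurse on the formula with the relations as
-- arguments).
sat : ∀ {k P} (W : Set) → (Fin (suc k) → W → W → Set) → (P → W → Set) →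
      W → Form k P → Set
sat W R V w (atom p) = V p w
sat W R V w (¬′ φ) = ¬ (sat W R V w φ)
sat W R V w (φ ∧′ ψ) = sat W R V w φ × sat W R V w ψ
sat W R V w (D G _ φ) = ∀ u → (∀ i → i ∈ G → R i w u) → sat W R V u φ
sat W R V w ([ ξ ] φ) =
  sat W R V w ξ →
  sat W (λ i u v → R i u v ×
           ((sat W R V u ξ × sat W R V v ξ) ⊎
            (¬ sat W R V u ξ × ¬ sat W R V v ξ))) V w φ

_,_⊩_ : ∀ {k P} (M : Model k P) → W M → Form k P → Set
M , w ⊩ φ = sat (W M) (R M) (V M) w φ

update : ∀ {k P} (M : Model k P) → Form k P → Model k P
update M ξ = record
  { W = W M
  ; R = λ i u v → R M i u v ×
                  (((M , u ⊩ ξ) × (M , v ⊩ ξ)) ⊎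
                   ((M , u ⊩ (¬′ ξ)) × (M , v ⊩ (¬′ ξ))))
  ; V = V M
  }

open import Relation.Binary.PropositionalEquality using (_≡_; refl)
announce-clause : ∀ {k P} (M : Model k P) w ξ φ →
  (M , w ⊩ ([ ξ ] φ)) ≡ ((M , w ⊩ ξ) → (update M ξ , w ⊩ φ))
announce-clause M w ξ φ = refl

record IsCollBisim {k P} (M M' : Model k P) (Z : W M → W M' → Set) : Set where
  field
    nonempty : Σ (W M) λ u → Σ (W M') λ u' → Z u u'
    atoms    : ∀ {u u'} → Z u u' → ∀ p → V M p u ⇔ V M' p u'
    forth    : ∀ {u u'} → Z u u' → ∀ (G : Subset (suc k)) v →
               RG M G u v → Σ (W M') λ v' → RG M' G u' v' × Z v v'
    back     : ∀ {u u'} → Z u u' → ∀ (G : Subset (suc k)) v' →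
               RG M' G u' v' → Σ (W M) λ v → RG M G u v × Z v v'

CollBisimilar : ∀ {k P} (M : Model k P) → W M → (M' : Model k P) → W M' → Set₁
CollBisimilar M w M' w' =
  Σ (W M → W M' → Set) λ Z → IsCollBisim M M' Z × Z w w'

-- Bisimulation invariance is proved by induction on the formula, simultaneously
-- for all models and all collective bisimulations.  The only non-standard case is
-- the announcement [ξ]φ: by induction ξ has the same truth value at Z-related
-- worlds, so Z relates ∼_ξ-equivalent pairs to ∼_ξ-equivalent pairs and is thus
-- still a collective bisimulation between M^{!ξ} and M'^{!ξ}, where the induction
-- hypothesis for φ applies.
module Submission where

open import Defs
open import Data.Nat using (ℕ)
open import Data.Product using (_×_; _,_; proj₁; proj₂)
open import Data.Product.Function.NonDependent.Propositional using (_×-⇔_)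
open import Data.Sum using (_⊎_)
open import Data.Sum.Function.Propositional using (_⊎-⇔_)
open import Function.Bundles using (_⇔_; _↣_; mk⇔; Equivalence)
open import Function.Related.TypeIsomorphisms using (→-cong-⇔; ¬-cong-⇔)

open Equivalence

SameTruthValue : ∀ {k P} (M : Model k P) → Form k P → W M → W M → Set
SameTruthValue M ξ u v =
  ((M , u ⊩ ξ) × (M , v ⊩ ξ)) ⊎ ((M , u ⊩ (¬′ ξ)) × (M , v ⊩ (¬′ ξ)))

module _ {k : ℕ} {P : Set} {M M' : Model k P} {Z : W M → W M' → Set} where

  Invariant : Form k P → Set
  Invariant ξ = ∀ {u u'} → Z u u' → (M , u ⊩ ξ) ⇔ (M' , u' ⊩ ξ)

  sameTruthValue-respects-invariant : ∀ ξ → Invariant ξ →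
    ∀ {u u' v v'} → Z u u' → Z v v' → SameTruthValue M ξ u v ⇔ SameTruthValue M' ξ u' v'
  sameTruthValue-respects-invariant _ inv zu zv =
    (inv zu ×-⇔ inv zv) ⊎-⇔ (¬-cong-⇔ (inv zu) ×-⇔ ¬-cong-⇔ (inv zv))

  update-preserves-bisim : IsCollBisim M M' Z → ∀ ξ → Invariant ξ →
                           IsCollBisim (update M ξ) (update M' ξ) Z
  update-preserves-bisim bisim ξ inv = record
    { nonempty = nonempty
    ; atoms    = atoms
    ; forth    = λ zu G v r →
        let v' , r' , zv = forth zu G v (λ i i∈G → proj₁ (r i i∈G))
        in v' , (λ i i∈G → r' i i∈G , to (same zu zv) (proj₂ (r i i∈G))) , zv
    ; back     = λ zu G v' r' →
        let v , r , zv = back zu G v' (λ i i∈G → proj₁ (r' i i∈G))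
        in v , (λ i i∈G → r i i∈G , from (same zu zv) (proj₂ (r' i i∈G))) , zv
    }
    where
    open IsCollBisim bisim
    same : ∀ {u u' v v'} → Z u u' → Z v v' →
           SameTruthValue M ξ u v ⇔ SameTruthValue M' ξ u' v'
    same = sameTruthValue-respects-invariant ξ inv

⊩-bisim-invariant : ∀ {k P} {M M' : Model k P} {Z : W M → W M' → Set} →
  IsCollBisim M M' Z → (φ : Form k P) →
  ∀ {u u'} → Z u u' → (M , u ⊩ φ) ⇔ (M' , u' ⊩ φ)
⊩-bisim-invariant bisim (atom p) zu = IsCollBisim.atoms bisim zu p
⊩-bisim-invariant bisim (¬′ φ) zu = ¬-cong-⇔ (⊩-bisim-invariant bisim φ zu)
⊩-bisim-invariant bisim (φ ∧′ ψ) zu =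
  ⊩-bisim-invariant bisim φ zu ×-⇔ ⊩-bisim-invariant bisim ψ zu
⊩-bisim-invariant {M = M} {M'} bisim (D G G≠∅ φ) {u} {u'} zu =
  mk⇔ □-to □-from
  where
  open IsCollBisim bisim
  □-to : (M , u ⊩ D G G≠∅ φ) → (M' , u' ⊩ D G G≠∅ φ)
  □-to □φ v' r' = let v , r , zv = back zu G v' r'
                       in to (⊩-bisim-invariant bisim φ zv) (□φ v r)
  □-from : (M' , u' ⊩ D G G≠∅ φ) → (M , u ⊩ D G G≠∅ φ)
  □-from □φ v r = let v' , r' , zv = forth zu G v r
                    in from (⊩-bisim-invariant bisim φ zv) (□φ v' r')
⊩-bisim-invariant {M = M} {M'} {Z} bisim ([ ξ ] φ) zu =
  →-cong-⇔ (invξ zu) (⊩-bisim-invariant (update-preserves-bisim bisim ξ invξ) φ zu)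
  where
  invξ : Invariant {M = M} {M'} {Z} ξ
  invξ = ⊩-bisim-invariant bisim ξ

theoremA1 : (k : ℕ) (P : Set) → P → P ↣ ℕ →
    (M M' : Model k P) (w : W M) (w' : W M') →
    CollBisimilar M w M' w' →
    (ψ : Form k P) → (M , w ⊩ ψ) ⇔ (M' , w' ⊩ ψ)
theoremA1 _ _ _ _ _ _ _ _ (Z , bisim , zw) ψ = ⊩-bisim-invariant bisim ψ zw
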